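{- There are infinitely many binary words $w$ such that $J_{\mathrm{rect}}(w)=Z(w)+1$.
   Context: Words are finite strings over $\{0,1\}$ (in the HP model $0$ stands for a hydrophobic monomer $H$ and $1$ for a polar monomer $P$). $Z(w)$ denotes the number of zeros in $w$. A fold of a word $w=w_1\cdots w_n$ in the 2D rectangular lattice $\mathbb Z^2$ (nearest-neighbour graph) is a self-avoiding walk $v_1,\dots,v_n$ in $\mathbb Z^2$, i.e. distinct vertices with $v_i$ adjacent to $v_{i+1}$ for $1\le i<n$; vertex $v_i$ is labelled $w_i$. The score of the fold is the number of pairs $\{i,j\}$ with $|i-j|\ge 2$, $w_i=w_j=0$, and $v_i,v_j$ adjacent in the lattice. $J_{\mathrm{rect}}(w)$ is the maximum score over all folds of $w$ in $\mathbb Z^2$. -}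

module Defs where

open import Data.Bool using (Bool; true; false; _∧_; if_then_else_)
open import Data.Fin using (Fin; zero; suc; toℕ; fromℕ<)
open import Data.Integer as ℤ using (ℤ; ∣_∣)
open import Data.List using (List; []; _∷_; length; lookup; allFin; map)
open import Data.Nat.ListAction using (sum)
open import Data.Nat using (ℕ; suc; _+_; _<_; _≤_; _≤ᵇ_; _≡ᵇ_)
open import Data.Product using (_×_; _,_; Σ)
open import Function.Definitions using (Injective)
open import Relation.Binary.PropositionalEquality using (_≡_)

-- Letters: 0 (hydrophobic H) and 1 (polar P).
Letter : Set
Letter = Fin 2

Word : Set
Word = List Letter

isZero : Letter → Bool
isZero zero    = true
isZero (suc _) = false

Z : Word → ℕ
Z []      = 0
Z (a ∷ w) = (if isZero a then 1 else 0) + Z w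

Point : Set
Point = ℤ × ℤ

Adjacent : Point → Point → Set
Adjacent (x , y) (x' , y') = ∣ x ℤ.- x' ∣ + ∣ y ℤ.- y' ∣ ≡ 1

adjacentᵇ : Point → Point → Bool
adjacentᵇ (x , y) (x' , y') = (∣ x ℤ.- x' ∣ + ∣ y ℤ.- y' ∣) ≡ᵇ 1

record Fold (w : Word) : Set where
  field
    pos        : Fin (length w) → Point
    distinct   : Injective _≡_ _≡_ pos
    consecutive : ∀ (i j : Fin (length w)) → suc (toℕ i) ≡ toℕ j →
                  Adjacent (pos i) (pos j)

score : (w : Word) → Fold w → ℕ
score w f = sum (map (λ i → sum (map (λ j → contact i j) (allFin (length w))))
                     (allFin (length w)))
  where
    open Fold f
    contact : Fin (length w) → Fin (length w) → ℕ
    contact i j =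
      if ((toℕ i + 2) ≤ᵇ toℕ j) ∧ isZero (lookup w i) ∧ isZero (lookup w j)
           ∧ adjacentᵇ (pos i) (pos j)
      then 1 else 0

JrectIs : Word → ℕ → Set
JrectIs w m = Σ (Fold w) (λ f → score w f ≡ m) × (∀ (f : Fold w) → score w f ≤ m)

module Submission where

-- Each vertex has four lattice neighbours and the walk occupies
-- two of them by chain neighbours (one at an end of the chain), so an H takes
-- part in at most 2 contacts, or 3 at an end; counting every contact from both
-- of its H's gives 2 score ≤ 2 Z + 2.  Conversely, a 26-letter word has a fold
-- whose six H's fill a 2 × 3 block of the lattice, with the ends of the chain
-- at the two middle cells, so that all seven edges of the block are contacts.
-- Splicing an arbitrarily long hairpin of P's into this fold, away from the
-- block, keeps the seven contacts: every word of the family has score Z + 1.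

open import Defs
open import Algebra.Bundles using (AbelianGroup)
import Algebra.Properties.CommutativeMonoid.Sum as Sum
import Algebra.Properties.Group as GroupProperties
open import Data.Bool using (Bool; true; false; _∧_; not; if_then_else_; T)
open import Data.Empty using (⊥; ⊥-elim)
open import Data.Fin using (Fin; zero; suc; toℕ; punchOut)
open import Data.Fin.Properties using (suc-injective; punchOut-injective; toℕ<n)
open import Data.Integer as ℤ using (ℤ; ∣_∣; -[1+_])
import Data.Integer.Properties as ℤP
open import Data.List
  using (List; []; _∷_; _++_; length; lookup; map; tabulate; allFin; last; applyUpTo; applyDownFrom)
open import Data.List.Properties
  using (map-++; map-∘; map-id; ++-assoc; length-map; length-++-≤ˡ; length-++-≤ʳ; length-applyUpTo)
open import Data.List.Relation.Binary.Disjoint.Propositional using (Disjoint)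
open import Data.List.Relation.Unary.All as All using (All; _∷_)
import Data.List.Relation.Unary.All.Properties as All
open import Data.List.Relation.Unary.Any using (here; there)
open import Data.List.Relation.Unary.Linked using (Linked; _∷_; linked?)
import Data.List.Relation.Unary.Linked.Properties as Linkedₚ
open import Data.List.Relation.Unary.Unique.DecPropositional using (unique?)
open import Data.List.Relation.Unary.Unique.Propositional using (Unique; _∷_)
import Data.List.Relation.Unary.Unique.Propositional.Properties as Uniqueₚ
open import Data.Maybe using (just)
open import Data.Maybe.Relation.Binary.Connected as Connected using (Connected)
open import Data.Nat
  using (ℕ; zero; suc; pred; _≟_; _+_; _≤_; _<_; _≤ᵇ_; _<ᵇ_; _≡ᵇ_; z≤n; s≤s; _≤?_)
open import Data.Nat.ListAction using () renaming (sum to sumList)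
open import Data.Nat.Properties hiding (suc-injective)
open import Data.Nat.Tactic.RingSolver using (solve-∀)
open import Data.Product using (_×_; _,_; Σ; proj₁; proj₂)
open import Data.Product.Properties using (≡-dec)
open import Data.Unit using (tt)
open import Data.Vec.Functional using (removeAt)
open import Data.Vec.Functional.Properties using (removeAt-punchOut)
open import Function using (_∘_; id)
open import Function.Definitions using (Injective)
open import Relation.Binary.Definitions using (DecidableEquality)
open import Relation.Binary.PropositionalEquality
open import Relation.Nullary using (¬_; Dec; isYes; yes; no)
open import Relation.Nullary.Decidable using (from-yes; fromWitness; ¬?)

module ℤGroup = GroupProperties (AbelianGroup.group ℤP.+-0-abelianGroup)

open Sum +-0-commutativeMonoid
  using (sum; sum-syntax; sum-cong-≗; sum-replicate-zero; sum-remove; ∑-distrib-+; ∑-comm)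

-- Indicators and finite sums

-- Written as in Defs, so that score unfolds to a double sum of χ's.
χ : Bool → ℕ
χ b = if b then 1 else 0

χ≤1 : ∀ b → χ b ≤ 1
χ≤1 true  = ≤-refl
χ≤1 false = z≤n

χ-∧-≤ˡ : ∀ a b → χ (a ∧ b) ≤ χ a
χ-∧-≤ˡ true  b = χ≤1 b
χ-∧-≤ˡ false b = z≤n

χ-∧-≤ʳ : ∀ a b → χ (a ∧ b) ≤ χ b
χ-∧-≤ʳ true  b = ≤-refl
χ-∧-≤ʳ false b = z≤n

χ-∧-monoˡ : ∀ {a b} c → (T a → T b) → χ (a ∧ c) ≤ χ (b ∧ c)
χ-∧-monoˡ {true}  {true}  c _   = ≤-refl
χ-∧-monoˡ {true}  {false} c a⇒b = ⊥-elim (a⇒b tt)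
χ-∧-monoˡ {false}         c _   = z≤n

χ-∧-exclusive : ∀ a b {c d e} → (T a → T b → ⊥) → χ c ≤ χ e → χ d ≤ χ e →
                χ (a ∧ c) + χ (b ∧ d) ≤ χ e
χ-∧-exclusive true  true  a⊥b _    _    = ⊥-elim (a⊥b tt tt)
χ-∧-exclusive true  false _   c≤e  _    = ≤-trans (≤-reflexive (+-identityʳ _)) c≤e
χ-∧-exclusive false b     _   _    d≤e  = ≤-trans (χ-∧-≤ʳ b _) d≤e

χ-false : ∀ {b} → ¬ T b → χ b ≡ 0
χ-false {true}  ¬b = ⊥-elim (¬b tt)
χ-false {false} _  = refl

χ-true : ∀ {b} → T b → χ b ≡ 1
χ-true {true} _ = refl

sumList-map-tabulate : ∀ {A : Set} {n} (g : A → ℕ) (h : Fin n → A) →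
                       sumList (map g (tabulate h)) ≡ ∑[ i < n ] g (h i)
sumList-map-tabulate {n = zero}  g h = refl
sumList-map-tabulate {n = suc n} g h = cong (g (h zero) +_) (sumList-map-tabulate g (h ∘ suc))

∑-mono-≤ : ∀ {n} {f g : Fin n → ℕ} → (∀ i → f i ≤ g i) → ∑[ i < n ] f i ≤ ∑[ i < n ] g i
∑-mono-≤ {zero}  _   = z≤n
∑-mono-≤ {suc n} f≤g = +-mono-≤ (f≤g zero) (∑-mono-≤ (f≤g ∘ suc))

term≤∑ : ∀ {n} (f : Fin n → ℕ) i → f i ≤ ∑[ j < n ] f j
term≤∑ {suc n} f i = ≤-trans (m≤m+n (f i) _) (≤-reflexive (sym (sum-remove {i = i} f)))

∑-∘-injective-≤ : ∀ {m n} (g : Fin n → ℕ) (e : Fin m → Fin n) → Injective _≡_ _≡_ e →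
                  ∑[ i < m ] g (e i) ≤ ∑[ j < n ] g j
∑-∘-injective-≤ {zero}          g e _     = z≤n
∑-∘-injective-≤ {suc m} {zero}  g e _     with e zero
... | ()
∑-∘-injective-≤ {suc m} {suc n} g e e-inj = begin
  g (e zero) + ∑[ i < m ] g (e (suc i))
    ≡⟨ cong (g (e zero) +_) (sum-cong-≗ (λ i → removeAt-punchOut g (e₀≢ i))) ⟨
  g (e zero) + ∑[ i < m ] removeAt g (e zero) (e′ i)
    ≤⟨ +-monoʳ-≤ (g (e zero)) (∑-∘-injective-≤ (removeAt g (e zero)) e′ e′-injective) ⟩
  g (e zero) + sum (removeAt g (e zero))
    ≡⟨ sum-remove {i = e zero} g ⟨
  sum g ∎
  where
  open ≤-Reasoning
  e₀≢ : ∀ i → e zero ≢ e (suc i)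
  e₀≢ i eq with e-inj eq
  ... | ()
  e′ : Fin m → Fin n
  e′ i = punchOut (e₀≢ i)
  e′-injective : Injective _≡_ _≡_ e′
  e′-injective eq = suc-injective (e-inj (punchOut-injective (e₀≢ _) (e₀≢ _) eq))

∑-χ-fibre≤1 : ∀ {A : Set} (_≟_ : DecidableEquality A) {n} (f : Fin n → A) →
              Injective _≡_ _≡_ f → ∀ a → ∑[ j < n ] χ (isYes (f j ≟ a)) ≤ 1
∑-χ-fibre≤1 _≟_ {zero}  f f-inj a = z≤n
∑-χ-fibre≤1 _≟_ {suc n} f f-inj a with f zero ≟ a
... | no  _      = ∑-χ-fibre≤1 _≟_ (f ∘ suc) (suc-injective ∘ f-inj) a
... | yes f₀≡a   = ≤-reflexive (cong suc (trans (sum-cong-≗ miss) (sum-replicate-zero n)))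
  where
  miss : ∀ j → χ (isYes (f (suc j) ≟ a)) ≡ 0
  miss j with f (suc j) ≟ a
  ... | no  _ = refl
  ... | yes fⱼ≡a with f-inj (trans fⱼ≡a (sym f₀≡a))
  ... | ()

∑-χ-≡ᵇ-toℕ : ∀ n m → ∑[ j < n ] χ (m ≡ᵇ toℕ j) ≡ χ (m <ᵇ n)
∑-χ-≡ᵇ-toℕ zero    m       = refl
∑-χ-≡ᵇ-toℕ (suc n) zero    = cong suc (sum-replicate-zero n)
∑-χ-≡ᵇ-toℕ (suc n) (suc m) = ∑-χ-≡ᵇ-toℕ n m

-- Lattice neighbourhoods

Δ : Point → Point → ℤ × ℤ
Δ (x , y) (x′ , y′) = (x ℤ.- x′ , y ℤ.- y′)

unit : Fin 4 → ℤ × ℤ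
unit zero                   = (ℤ.+ 1 , ℤ.+ 0)
unit (suc zero)             = (-[1+ 0 ] , ℤ.+ 0)
unit (suc (suc zero))       = (ℤ.+ 0 , ℤ.+ 1)
unit (suc (suc (suc zero))) = (ℤ.+ 0 , -[1+ 0 ])

∣a∣+∣b∣≡1⇒unit : ∀ a b → ∣ a ∣ + ∣ b ∣ ≡ 1 → Σ (Fin 4) (λ d → (a , b) ≡ unit d)
∣a∣+∣b∣≡1⇒unit (ℤ.+ 1) (ℤ.+ 0)  _ = zero , refl
∣a∣+∣b∣≡1⇒unit -[1+ 0 ] (ℤ.+ 0) _ = suc zero , refl
∣a∣+∣b∣≡1⇒unit (ℤ.+ 0) (ℤ.+ 1)  _ = suc (suc zero) , refl
∣a∣+∣b∣≡1⇒unit (ℤ.+ 0) -[1+ 0 ] _ = suc (suc (suc zero)) , refl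
∣a∣+∣b∣≡1⇒unit (ℤ.+ 0) (ℤ.+ 0) ()
∣a∣+∣b∣≡1⇒unit (ℤ.+ 0) (ℤ.+ suc (suc _)) ()
∣a∣+∣b∣≡1⇒unit (ℤ.+ 0) -[1+ suc _ ] ()
∣a∣+∣b∣≡1⇒unit (ℤ.+ 1) (ℤ.+ suc _) ()
∣a∣+∣b∣≡1⇒unit (ℤ.+ 1) -[1+ _ ] ()
∣a∣+∣b∣≡1⇒unit (ℤ.+ suc (suc _)) _ ()
∣a∣+∣b∣≡1⇒unit -[1+ 0 ] (ℤ.+ suc _) ()
∣a∣+∣b∣≡1⇒unit -[1+ 0 ] -[1+ _ ] ()
∣a∣+∣b∣≡1⇒unit -[1+ suc _ ] _ ()

adjacent⇒unit : ∀ p q → T (adjacentᵇ p q) → Σ (Fin 4) (λ d → Δ p q ≡ unit d)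
adjacent⇒unit (x , y) (x′ , y′) adj = ∣a∣+∣b∣≡1⇒unit _ _ (≡ᵇ⇒≡ _ 1 adj)

Δ-injective : ∀ p → Injective _≡_ _≡_ (Δ p)
Δ-injective (x , y) {x₁ , y₁} {x₂ , y₂} eq =
  cong₂ _,_ (cancel x (cong proj₁ eq)) (cancel y (cong proj₂ eq))
  where
  cancel : ∀ a {b c} → a ℤ.- b ≡ a ℤ.- c → b ≡ c
  cancel a eq = ℤP.neg-injective (ℤGroup.∙-cancelˡ a _ _ eq)

adjacentᵇ-sym : ∀ p q → adjacentᵇ p q ≡ adjacentᵇ q p
adjacentᵇ-sym (x , y) (x′ , y′) = cong₂ (λ a b → (a + b) ≡ᵇ 1) (ℤP.∣i-j∣≡∣j-i∣ x x′) (ℤP.∣i-j∣≡∣j-i∣ y y′)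

_≟ₚ_ : DecidableEquality (ℤ × ℤ)
_≟ₚ_ = ≡-dec ℤ._≟_ ℤ._≟_

χ-adjacent≤∑-unit : ∀ p q → χ (adjacentᵇ p q) ≤ ∑[ d < 4 ] χ (isYes (Δ p q ≟ₚ unit d))
χ-adjacent≤∑-unit p q with adjacentᵇ p q in adj
... | false = z≤n
... | true with adjacent⇒unit p q (subst T (sym adj) tt)
...   | d , Δ≡d = ≤-trans (≤-reflexive (sym (χ-true (fromWitness {a? = Δ p q ≟ₚ unit d} Δ≡d))))
                      (term≤∑ (λ d → χ (isYes (Δ p q ≟ₚ unit d))) d)

adjacent-count≤4 : ∀ {n} (pos : Fin n → Point) → Injective _≡_ _≡_ pos →
                   ∀ p → ∑[ j < n ] χ (adjacentᵇ p (pos j)) ≤ 4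
adjacent-count≤4 {n} pos pos-inj p = begin
  ∑[ j < n ] χ (adjacentᵇ p (pos j))                       ≤⟨ ∑-mono-≤ (χ-adjacent≤∑-unit p ∘ pos) ⟩
  ∑[ j < n ] ∑[ d < 4 ] χ (isYes (Δ p (pos j) ≟ₚ unit d))   ≡⟨ ∑-comm (λ j d → χ (isYes (Δ p (pos j) ≟ₚ unit d))) ⟩
  ∑[ d < 4 ] ∑[ j < n ] χ (isYes (Δ p (pos j) ≟ₚ unit d))   ≤⟨ ∑-mono-≤ (∑-χ-fibre≤1 _≟ₚ_ (Δ p ∘ pos) (pos-inj ∘ Δ-injective p) ∘ unit) ⟩
  ∑[ d < 4 ] 1                                             ≡⟨⟩
  4                                                        ∎
  where open ≤-Reasoning

-- The upper bound

suc-<ᵇ≡not-≡ᵇ-suc : ∀ {t n} → t < n → (suc t <ᵇ n) ≡ not (n ≡ᵇ suc t)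
suc-<ᵇ≡not-≡ᵇ-suc {zero}  {suc zero}    _           = refl
suc-<ᵇ≡not-≡ᵇ-suc {zero}  {suc (suc n)} _           = refl
suc-<ᵇ≡not-≡ᵇ-suc {suc t} {suc n}       (s≤s t<n)   = suc-<ᵇ≡not-≡ᵇ-suc t<n

∑-χ-successor : ∀ n t → t < n → ∑[ j < n ] χ (suc t ≡ᵇ toℕ j) ≡ χ (not (n ≡ᵇ suc t))
∑-χ-successor n t t<n = trans (∑-χ-≡ᵇ-toℕ n (suc t)) (cong χ (suc-<ᵇ≡not-≡ᵇ-suc t<n))

∑-χ-predecessor : ∀ n t → t < n → ∑[ j < n ] χ (t ≡ᵇ suc (toℕ j)) ≡ χ (not (0 ≡ᵇ t))
∑-χ-predecessor n zero    _   = sum-replicate-zero n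
∑-χ-predecessor n (suc t) t<n = trans (∑-χ-≡ᵇ-toℕ n t) (χ-true (<⇒<ᵇ (<-trans (n<1+n t) t<n)))

∑-χ-first≤1 : ∀ n → ∑[ i < n ] χ (0 ≡ᵇ toℕ i) ≤ 1
∑-χ-first≤1 n = ≤-trans (≤-reflexive (∑-χ-≡ᵇ-toℕ n 0)) (χ≤1 _)

∑-χ-last≤1 : ∀ n → ∑[ i < n ] χ (n ≡ᵇ suc (toℕ i)) ≤ 1
∑-χ-last≤1 zero    = z≤n
∑-χ-last≤1 (suc n) = ≤-trans (≤-reflexive (∑-χ-≡ᵇ-toℕ (suc n) n)) (χ≤1 _)

∑-χ-isZero≡Z : ∀ w → ∑[ i < length w ] χ (isZero (lookup w i)) ≡ Z w
∑-χ-isZero≡Z []      = refl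
∑-χ-isZero≡Z (a ∷ w) = cong (χ (isZero a) +_) (∑-χ-isZero≡Z w)

near⇒¬far : ∀ a b → suc a ≡ b → ¬ (a + 2 ≤ b) × ¬ (b + 2 ≤ a)
near⇒¬far a _ refl = (λ le → 2≰1 (+-cancelʳ-≤ a 2 1 (subst (_≤ suc a) (+-comm a 2) le)))
                   , (λ le → 1+n≰n (m+n≤o⇒m≤o (suc a) le))
  where
  2≰1 : ¬ 2 ≤ 1
  2≰1 (s≤s ())

m+χ¬a+χ¬b≤4⇒m≤2+χb+χa : ∀ x a b → x + (χ (not a) + χ (not b)) ≤ 4 → x ≤ 2 + (χ b + χ a)
m+χ¬a+χ¬b≤4⇒m≤2+χb+χa x true  true  le = m+n≤o⇒m≤o x le
m+χ¬a+χ¬b≤4⇒m≤2+χb+χa x true  false le = +-cancelʳ-≤ 1 x 3 le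
m+χ¬a+χ¬b≤4⇒m≤2+χb+χa x false true  le = +-cancelʳ-≤ 1 x 3 le
m+χ¬a+χ¬b≤4⇒m≤2+χb+χa x false false le = +-cancelʳ-≤ 2 x 2 le

m+m≤n+n⇒m≤n : ∀ {m n} → m + m ≤ n + n → m ≤ n
m+m≤n+n⇒m≤n {m} {n} le with m ≤? n
... | yes m≤n = m≤n
... | no  m≰n = ⊥-elim (<⇒≱ (+-mono-< (≰⇒> m≰n) (≰⇒> m≰n)) le)

module Contacts {w : Word} (f : Fold w) where
  open Fold f

  n : ℕ
  n = length w

  zeroAt : Fin n → Bool
  zeroAt i = isZero (lookup w i)

  far : Fin n → Fin n → Bool
  far i j = toℕ i + 2 ≤ᵇ toℕ j

  contact : Fin n → Fin n → ℕ
  contact i j = χ (far i j ∧ zeroAt i ∧ zeroAt j ∧ adjacentᵇ (pos i) (pos j))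

  score≡∑∑contact : score w f ≡ ∑[ i < n ] ∑[ j < n ] contact i j
  score≡∑∑contact = trans (sumList-map-tabulate (λ i → sumList (map (contact i) (allFin n))) id)
                          (sum-cong-≗ (λ i → sumList-map-tabulate (contact i) id))

  degree : Fin n → ℕ
  degree i = ∑[ j < n ] (contact i j + contact j i)

  ∑degree≡score+score : ∑[ i < n ] degree i ≡ score w f + score w f
  ∑degree≡score+score = begin
    ∑[ i < n ] ∑[ j < n ] (contact i j + contact j i)
      ≡⟨ sum-cong-≗ (λ i → ∑-distrib-+ (contact i) (λ j → contact j i)) ⟩
    ∑[ i < n ] (∑[ j < n ] contact i j + ∑[ j < n ] contact j i)
      ≡⟨ ∑-distrib-+ (λ i → ∑[ j < n ] contact i j) (λ i → ∑[ j < n ] contact j i) ⟩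
    ∑[ i < n ] ∑[ j < n ] contact i j + ∑[ i < n ] ∑[ j < n ] contact j i
      ≡⟨ cong (∑[ i < n ] ∑[ j < n ] contact i j +_) (∑-comm (λ i j → contact j i)) ⟩
    ∑[ i < n ] ∑[ j < n ] contact i j + ∑[ j < n ] ∑[ i < n ] contact j i
      ≡⟨ cong₂ _+_ score≡∑∑contact score≡∑∑contact ⟨
    score w f + score w f ∎
    where open ≡-Reasoning

  contact≤χ-zeroAtˡ : ∀ i j → contact i j ≤ χ (zeroAt i)
  contact≤χ-zeroAtˡ i j = ≤-trans (χ-∧-≤ʳ (far i j) _) (χ-∧-≤ˡ (zeroAt i) _)

  contact≤χ-zeroAtʳ : ∀ i j → contact i j ≤ χ (zeroAt j)
  contact≤χ-zeroAtʳ i j = ≤-trans (χ-∧-≤ʳ (far i j) _)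
                         (≤-trans (χ-∧-≤ʳ (zeroAt i) _) (χ-∧-≤ˡ (zeroAt j) _))

  ¬far⇒contact≡0 : ∀ i j → ¬ (toℕ i + 2 ≤ toℕ j) → contact i j ≡ 0
  ¬far⇒contact≡0 i j ¬far = n≤0⇒n≡0 (≤-trans (χ-∧-≤ˡ (far i j) _)
                                   (≤-reflexive (χ-false (¬far ∘ ≤ᵇ⇒≤ _ _))))

  contact-pair≤χ-adjacent : ∀ i j → contact i j + contact j i ≤ χ (adjacentᵇ (pos i) (pos j))
  contact-pair≤χ-adjacent i j =
    χ-∧-exclusive (far i j) (far j i) (far-exclusive i j)
      (≤-trans (χ-∧-≤ʳ (zeroAt i) _) (χ-∧-≤ʳ (zeroAt j) _))
      (≤-trans (χ-∧-≤ʳ (zeroAt j) _)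
               (≤-trans (χ-∧-≤ʳ (zeroAt i) _) (≤-reflexive (cong χ (adjacentᵇ-sym (pos j) (pos i))))))
    where
    far-exclusive : ∀ i j → T (far i j) → T (far j i) → ⊥
    far-exclusive i j fᵢⱼ fⱼᵢ = <-asym (far⇒< i j fᵢⱼ) (far⇒< j i fⱼᵢ)
      where
      far⇒< : ∀ a b → T (far a b) → toℕ a < toℕ b
      far⇒< a b le = m+n≤o⇒m≤o (suc (toℕ a)) (subst (_≤ toℕ b) (+-suc (toℕ a) 1) (≤ᵇ⇒≤ _ _ le))

  contacts+link≤adjacent : ∀ i j → suc (toℕ i) ≡ toℕ j → contact i j + contact j i + 1 ≤ χ (adjacentᵇ (pos i) (pos j))
  contacts+link≤adjacent i j i~j = begin
    contact i j + contact j i + 1 ≡⟨ cong₂ (λ a b → a + b + 1) (¬far⇒contact≡0 i j ¬far) (¬far⇒contact≡0 j i ¬far′) ⟩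
    1                             ≡⟨ χ-true (≡⇒≡ᵇ _ 1 (consecutive i j i~j)) ⟨
    χ (adjacentᵇ (pos i) (pos j)) ∎
    where
    open ≤-Reasoning
    ¬far = proj₁ (near⇒¬far (toℕ i) (toℕ j) i~j)
    ¬far′ = proj₂ (near⇒¬far (toℕ i) (toℕ j) i~j)

  contacts+links≤adjacent : ∀ i j → contact i j + contact j i + (χ (suc (toℕ i) ≡ᵇ toℕ j) + χ (toℕ i ≡ᵇ suc (toℕ j)))
                          ≤ χ (adjacentᵇ (pos i) (pos j))
  contacts+links≤adjacent i j with suc (toℕ i) ≡ᵇ toℕ j in succ | toℕ i ≡ᵇ suc (toℕ j) in pred
  ... | false | false = ≤-trans (≤-reflexive (+-identityʳ _)) (contact-pair≤χ-adjacent i j)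
  ... | true  | false = contacts+link≤adjacent i j (≡ᵇ⇒≡ _ _ (subst T (sym succ) tt))
  ... | false | true  = subst₂ _≤_ (cong (_+ 1) (+-comm (contact j i) (contact i j)))
                                   (cong χ (adjacentᵇ-sym (pos j) (pos i)))
                                   (contacts+link≤adjacent j i (sym (≡ᵇ⇒≡ _ _ (subst T (sym pred) tt))))
  ... | true  | true  = ⊥-elim (m≢1+n+m (toℕ i) {1}
                          (trans (≡ᵇ⇒≡ _ _ (subst T (sym pred) tt)) (cong suc (sym (≡ᵇ⇒≡ _ _ (subst T (sym succ) tt))))))

  isFirst isLast : Fin n → Bool
  isFirst i = 0 ≡ᵇ toℕ i
  isLast  i = n ≡ᵇ suc (toℕ i)

  degree≤2+ends : ∀ i → degree i ≤ 2 + (χ (isFirst i) + χ (isLast i))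
  degree≤2+ends i = m+χ¬a+χ¬b≤4⇒m≤2+χb+χa (degree i) (isLast i) (isFirst i) (begin
    degree i + (χ (not (isLast i)) + χ (not (isFirst i)))
      ≡⟨ cong (degree i +_) (cong₂ _+_ (∑-χ-successor n t t<n) (∑-χ-predecessor n t t<n)) ⟨
    degree i + (∑[ j < n ] χ (suc t ≡ᵇ toℕ j) + ∑[ j < n ] χ (t ≡ᵇ suc (toℕ j)))
      ≡⟨ cong (degree i +_) (∑-distrib-+ {n} (λ j → χ (suc t ≡ᵇ toℕ j)) (λ j → χ (t ≡ᵇ suc (toℕ j)))) ⟨
    degree i + ∑[ j < n ] (χ (suc t ≡ᵇ toℕ j) + χ (t ≡ᵇ suc (toℕ j)))
      ≡⟨ ∑-distrib-+ {n} (λ j → contact i j + contact j i) _ ⟨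
    ∑[ j < n ] (contact i j + contact j i + (χ (suc t ≡ᵇ toℕ j) + χ (t ≡ᵇ suc (toℕ j))))
      ≤⟨ ∑-mono-≤ (contacts+links≤adjacent i) ⟩
    ∑[ j < n ] χ (adjacentᵇ (pos i) (pos j))
      ≤⟨ adjacent-count≤4 pos distinct (pos i) ⟩
    4 ∎)
    where
    open ≤-Reasoning
    t = toℕ i
    t<n = toℕ<n i

  degree≤ : ∀ i → degree i ≤ χ (zeroAt i) + χ (zeroAt i) + (χ (isFirst i) + χ (isLast i))
  degree≤ i = by-zeroAt (zeroAt i) refl
    where
    by-zeroAt : ∀ b → zeroAt i ≡ b → degree i ≤ χ b + χ b + (χ (isFirst i) + χ (isLast i))
    by-zeroAt true  _  = degree≤2+ends i
    by-zeroAt false z = ≤-trans (≤-trans (∑-mono-≤ vanishes) (≤-reflexive (sum-replicate-zero n))) z≤n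
      where
      vanishes : ∀ j → contact i j + contact j i ≤ 0
      vanishes j = subst (λ b → contact i j + contact j i ≤ χ b + χ b) z
                      (+-mono-≤ (contact≤χ-zeroAtˡ i j) (contact≤χ-zeroAtʳ j i))

  ∑degree≤ : ∑[ i < n ] degree i ≤ Z w + Z w + (1 + 1)
  ∑degree≤ = begin
    ∑[ i < n ] degree i
      ≤⟨ ∑-mono-≤ degree≤ ⟩
    ∑[ i < n ] (χ (zeroAt i) + χ (zeroAt i) + (χ (isFirst i) + χ (isLast i)))
      ≡⟨ ∑-distrib-+ (λ i → χ (zeroAt i) + χ (zeroAt i)) (λ i → χ (isFirst i) + χ (isLast i)) ⟩
    ∑[ i < n ] (χ (zeroAt i) + χ (zeroAt i)) + ∑[ i < n ] (χ (isFirst i) + χ (isLast i))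
      ≡⟨ cong₂ _+_ (∑-distrib-+ (χ ∘ zeroAt) (χ ∘ zeroAt)) (∑-distrib-+ (χ ∘ isFirst) (χ ∘ isLast)) ⟩
    (∑[ i < n ] χ (zeroAt i) + ∑[ i < n ] χ (zeroAt i)) + (∑[ i < n ] χ (isFirst i) + ∑[ i < n ] χ (isLast i))
      ≤⟨ +-mono-≤ (≤-reflexive (cong₂ _+_ (∑-χ-isZero≡Z w) (∑-χ-isZero≡Z w)))
                  (+-mono-≤ (∑-χ-first≤1 n) (∑-χ-last≤1 n)) ⟩
    Z w + Z w + (1 + 1) ∎
    where open ≤-Reasoning

score≤Z+1 : ∀ w (f : Fold w) → score w f ≤ Z w + 1
score≤Z+1 w f = m+m≤n+n⇒m≤n (begin
  score w f + score w f   ≡⟨ ∑degree≡score+score ⟨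
  ∑[ i < n ] degree i     ≤⟨ ∑degree≤ ⟩
  Z w + Z w + (1 + 1)     ≡⟨ regroup (Z w) ⟩
  Z w + 1 + (Z w + 1)     ∎)
  where
  open Contacts f
  open ≤-Reasoning
  regroup : ∀ z → z + z + (1 + 1) ≡ z + 1 + (z + 1)
  regroup = solve-∀

-- Chains and splicing

score-mono : ∀ {u w} (f : Fold u) (g : Fold w) (e : Fin (length u) → Fin (length w)) →
             Injective _≡_ _≡_ e →
             (∀ i j → toℕ i + 2 ≤ toℕ j → toℕ (e i) + 2 ≤ toℕ (e j)) →
             (∀ i → lookup w (e i) ≡ lookup u i) →
             (∀ i → Fold.pos g (e i) ≡ Fold.pos f i) →
             score u f ≤ score w g
score-mono {u} {w} f g e e-inj e-gap e-lookup e-pos = begin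
  score u f                                      ≡⟨ U.score≡∑∑contact ⟩
  ∑[ i < U.n ] ∑[ j < U.n ] U.contact i j        ≤⟨ ∑-mono-≤ (λ i → ∑-mono-≤ (contact≤ i)) ⟩
  ∑[ i < U.n ] ∑[ j < U.n ] W.contact (e i) (e j) ≤⟨ ∑-mono-≤ (λ i → ∑-∘-injective-≤ (W.contact (e i)) e e-inj) ⟩
  ∑[ i < U.n ] ∑[ j < W.n ] W.contact (e i) j     ≤⟨ ∑-∘-injective-≤ (λ i → ∑[ j < W.n ] W.contact i j) e e-inj ⟩
  ∑[ i < W.n ] ∑[ j < W.n ] W.contact i j        ≡⟨ W.score≡∑∑contact ⟨
  score w g                                      ∎
  where
  open ≤-Reasoning
  module U = Contacts f
  module W = Contacts g
  contact≤ : ∀ i j → U.contact i j ≤ W.contact (e i) (e j)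
  contact≤ i j = subst (λ x → U.contact i j ≤ χ (W.far (e i) (e j) ∧ x))
    (sym (cong₂ _∧_ (cong isZero (e-lookup i))
                    (cong₂ _∧_ (cong isZero (e-lookup j)) (cong₂ adjacentᵇ (e-pos i) (e-pos j)))))
    (χ-∧-monoˡ _ (λ far → ≤⇒≤ᵇ (e-gap i j (≤ᵇ⇒≤ _ _ far))))

Chain : Set
Chain = List (Letter × Point)

word : Chain → Word
word = map proj₁

points : Chain → List Point
points = map proj₂

place : (c : Chain) → Fin (length (word c)) → Point
place (s ∷ c) zero    = proj₂ s
place (s ∷ c) (suc i) = place c i

All-place : ∀ {P : Point → Set} c → All P (points c) → ∀ i → P (place c i)
All-place (s ∷ c) (p ∷ _)  zero    = p
All-place (s ∷ c) (_ ∷ ps) (suc i) = All-place c ps i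

place-injective : ∀ c → Unique (points c) → Injective _≡_ _≡_ (place c)
place-injective (s ∷ c) (_   ∷ _) {zero}  {zero}  _  = refl
place-injective (s ∷ c) (s∉c ∷ _) {zero}  {suc j} eq = ⊥-elim (All-place c s∉c j eq)
place-injective (s ∷ c) (s∉c ∷ _) {suc i} {zero}  eq = ⊥-elim (All-place c s∉c i (sym eq))
place-injective (s ∷ c) (_ ∷ uc)  {suc i} {suc j} eq = cong suc (place-injective c uc eq)

place-linked : ∀ {R : Point → Point → Set} c → Linked R (points c) →
               ∀ i j → suc (toℕ i) ≡ toℕ j → R (place c i) (place c j)
place-linked (s ∷ s′ ∷ c) (r ∷ _)  zero    (suc zero) _  = r
place-linked (s ∷ s′ ∷ c) (_ ∷ rs) (suc i) (suc j)    eq = place-linked (s′ ∷ c) rs i j (cong pred eq)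
place-linked (s ∷ s′ ∷ c) _        zero    (suc (suc j)) ()

chainFold : ∀ c → Unique (points c) → Linked Adjacent (points c) → Fold (word c)
chainFold c unique linked = record
  { pos         = place c
  ; distinct    = place-injective c unique
  ; consecutive = place-linked c linked
  }

skip : ∀ ys {zs} → Fin (length (word zs)) → Fin (length (word (ys ++ zs)))
skip []       i = i
skip (_ ∷ ys) i = suc (skip ys i)

embed : ∀ xs ys {zs} → Fin (length (word (xs ++ zs))) → Fin (length (word (xs ++ ys ++ zs)))
embed []       ys i       = skip ys i
embed (_ ∷ xs) ys zero    = zero
embed (_ ∷ xs) ys (suc i) = suc (embed xs ys i)

skip-place : ∀ ys {zs} i → place (ys ++ zs) (skip ys i) ≡ place zs i
skip-place []       i = refl
skip-place (_ ∷ ys) i = skip-place ys i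

embed-place : ∀ xs ys {zs} i → place (xs ++ ys ++ zs) (embed xs ys i) ≡ place (xs ++ zs) i
embed-place []       ys i       = skip-place ys i
embed-place (_ ∷ xs) ys zero    = refl
embed-place (_ ∷ xs) ys (suc i) = embed-place xs ys i

skip-lookup : ∀ ys {zs} i → lookup (word (ys ++ zs)) (skip ys i) ≡ lookup (word zs) i
skip-lookup []       i = refl
skip-lookup (_ ∷ ys) i = skip-lookup ys i

embed-lookup : ∀ xs ys {zs} i → lookup (word (xs ++ ys ++ zs)) (embed xs ys i) ≡ lookup (word (xs ++ zs)) i
embed-lookup []       ys i       = skip-lookup ys i
embed-lookup (_ ∷ xs) ys zero    = refl
embed-lookup (_ ∷ xs) ys (suc i) = embed-lookup xs ys i

skip-injective : ∀ ys {zs} → Injective _≡_ _≡_ (skip ys {zs})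
skip-injective []       eq = eq
skip-injective (_ ∷ ys) eq = skip-injective ys (suc-injective eq)

embed-injective : ∀ xs ys {zs} → Injective _≡_ _≡_ (embed xs ys {zs})
embed-injective []       ys                 eq = skip-injective ys eq
embed-injective (_ ∷ xs) ys {zs} {zero}  {zero}  _  = refl
embed-injective (_ ∷ xs) ys {zs} {suc i} {suc j} eq = cong suc (embed-injective xs ys (suc-injective eq))

skip-inflationary : ∀ ys {zs} i → toℕ i ≤ toℕ (skip ys {zs} i)
skip-inflationary []       i = ≤-refl
skip-inflationary (_ ∷ ys) i = m≤n⇒m≤1+n (skip-inflationary ys i)

embed-inflationary : ∀ xs ys {zs} i → toℕ i ≤ toℕ (embed xs ys {zs} i)
embed-inflationary []       ys i       = skip-inflationary ys i
embed-inflationary (_ ∷ xs) ys zero    = z≤n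
embed-inflationary (_ ∷ xs) ys (suc i) = s≤s (embed-inflationary xs ys i)

skip-gap : ∀ ys {zs} d (i j : Fin (length (word zs))) → toℕ i + d ≤ toℕ j → toℕ (skip ys {zs} i) + d ≤ toℕ (skip ys {zs} j)
skip-gap []       d i j le = le
skip-gap (_ ∷ ys) {zs} d i j le = s≤s (skip-gap ys {zs} d i j le)

embed-gap : ∀ xs ys {zs} d (i j : Fin (length (word (xs ++ zs)))) → toℕ i + d ≤ toℕ j → toℕ (embed xs ys {zs} i) + d ≤ toℕ (embed xs ys {zs} j)
embed-gap []       ys {zs} d i       j       le       = skip-gap ys {zs} d i j le
embed-gap (_ ∷ xs) ys      d zero    zero    le       = le
embed-gap (_ ∷ xs) ys {zs} d zero    (suc j) le       = ≤-trans le (s≤s (embed-inflationary xs ys {zs} j))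
embed-gap (_ ∷ xs) ys {zs} d (suc i) (suc j) (s≤s le) = s≤s (embed-gap xs ys {zs} d i j le)

Unique-splice : ∀ {A : Set} (xs : List A) {ys zs} → Unique (xs ++ zs) → Unique ys →
                Disjoint ys (xs ++ zs) → Unique (xs ++ ys ++ zs)
Unique-splice []           uzs uys ys#zs = Uniqueₚ.++⁺ uys uzs ys#zs
Unique-splice (x ∷ xs) {ys} (x∉ ∷ u) uys ys#x∷xs =
  All.++⁺ (All.++⁻ˡ xs x∉) (All.++⁺ x∉ys (All.++⁻ʳ xs x∉)) ∷
  Unique-splice xs u uys (λ (v∈ys , v∈) → ys#x∷xs (v∈ys , there v∈))
  where
  x∉ys : All (x ≢_) ys
  x∉ys = All.tabulate (λ v∈ys x≡v → ys#x∷xs (v∈ys , here (sym x≡v)))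

separated⇒Disjoint : ∀ {A : Set} {P : A → Set} {xs ys} → All P xs → All (¬_ ∘ P) ys → Disjoint xs ys
separated⇒Disjoint all-P all-¬P (v∈xs , v∈ys) = All.lookup all-¬P v∈ys (All.lookup all-P v∈xs)

last-applyUpTo : ∀ {A : Set} (f : ℕ → A) n → last (applyUpTo f (suc n)) ≡ just (f n)
last-applyUpTo f zero    = refl
last-applyUpTo f (suc n) = last-applyUpTo (f ∘ suc) n

last-applyDownFrom : ∀ {A : Set} (f : ℕ → A) n → last (applyDownFrom f (suc n)) ≡ just (f 0)
last-applyDownFrom f zero    = refl
last-applyDownFrom f (suc n) = last-applyDownFrom f n

-- The family of optimal words

pt : ℕ → ℕ → Point
pt x y = (ℤ.+ x , ℤ.+ y)

pt-injectiveˣ : ∀ {a b y y′} → pt a y ≡ pt b y′ → a ≡ b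
pt-injectiveˣ refl = refl

∣n⊖1+n∣≡1 : ∀ n → ∣ n ℤ.⊖ suc n ∣ ≡ 1
∣n⊖1+n∣≡1 n = trans (ℤP.∣⊖∣-< (n<1+n n)) (m+n∸n≡m 1 n)

adjacent-east : ∀ x y → Adjacent (pt x y) (pt (suc x) y)
adjacent-east x y = cong₂ _+_ (∣n⊖1+n∣≡1 x) (cong ∣_∣ (ℤP.+-inverseʳ (ℤ.+ y)))

adjacent-north : ∀ x y → Adjacent (pt x y) (pt x (suc y))
adjacent-north x y = cong₂ _+_ (cong ∣_∣ (ℤP.+-inverseʳ (ℤ.+ x))) (∣n⊖1+n∣≡1 y)

adjacent-sym : ∀ {p q} → Adjacent p q → Adjacent q p
adjacent-sym {x , y} {x′ , y′} adj = trans (cong₂ _+_ (ℤP.∣i-j∣≡∣j-i∣ x′ x) (ℤP.∣i-j∣≡∣j-i∣ y′ y)) adj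

adjacent-west : ∀ x y → Adjacent (pt (suc x) y) (pt x y)
adjacent-west x y = adjacent-sym {pt x y} {pt (suc x) y} (adjacent-east x y)

adjacent-south : ∀ x y → Adjacent (pt x (suc y)) (pt x y)
adjacent-south x y = adjacent-sym {pt x y} {pt x (suc y)} (adjacent-north x y)

adjacent? : ∀ p q → Dec (Adjacent p q)
adjacent? (x , y) (x′ , y′) = ∣ x ℤ.- x′ ∣ + ∣ y ℤ.- y′ ∣ ≟ 1

𝟘 𝟙 : Letter
𝟘 = zero
𝟙 = suc zero

polar : Point → Letter × Point
polar p = (𝟙 , p)

Z-polar : ∀ ps c → Z (word (map polar ps ++ c)) ≡ Z (word c)
Z-polar []       c = refl
Z-polar (_ ∷ ps) c = Z-polar ps c

-- The six H's fill the block [2,4] × [2,3]; the ends of the chain are its middle cells.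
core₁ core₂ core : Chain
core₁ = (𝟘 , pt 3 2) ∷ (𝟙 , pt 3 1) ∷ (𝟙 , pt 4 1) ∷ (𝟘 , pt 4 2) ∷ (𝟙 , pt 5 2)
      ∷ (𝟙 , pt 5 3) ∷ (𝟘 , pt 4 3) ∷ (𝟙 , pt 4 4) ∷ (𝟙 , pt 5 4) ∷ (𝟙 , pt 6 4) ∷ []
core₂ = (𝟙 , pt 6 3) ∷ (𝟙 , pt 6 2) ∷ (𝟙 , pt 6 1) ∷ (𝟙 , pt 6 0) ∷ (𝟙 , pt 5 0)
      ∷ (𝟙 , pt 4 0) ∷ (𝟙 , pt 3 0) ∷ (𝟙 , pt 2 0) ∷ (𝟙 , pt 2 1) ∷ (𝟘 , pt 2 2)
      ∷ (𝟙 , pt 1 2) ∷ (𝟙 , pt 1 3) ∷ (𝟘 , pt 2 3) ∷ (𝟙 , pt 2 4) ∷ (𝟙 , pt 3 4) ∷ (𝟘 , pt 3 3) ∷ []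
core  = core₁ ++ core₂

unique-core : Unique (points core)
unique-core = from-yes (unique? _≟ₚ_ (points core))

coreFold : Fold (word core)
coreFold = chainFold core unique-core (from-yes (linked? adjacent? (points core)))

score-core : score (word core) coreFold ≡ 7
score-core = refl

module Family (M : ℕ) where
  out back : ℕ → Point
  out  k = pt (7 + k) 4
  back k = pt (7 + k) 3

  outRow backRow hairpinPoints : List Point
  outRow        = applyUpTo out (suc M)
  backRow       = applyDownFrom back (suc M)
  hairpinPoints = outRow ++ backRow

  hairpin family : Chain
  hairpin = map polar hairpinPoints
  family  = core₁ ++ hairpin ++ core₂

  points-family : points family ≡ points core₁ ++ hairpinPoints ++ points core₂
  points-family = cong (points core₁ ++_) (trans (map-++ proj₂ hairpin core₂)
                       (cong (_++ points core₂) (trans (sym (map-∘ hairpinPoints)) (map-id hairpinPoints))))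

  unique-hairpin : Unique hairpinPoints
  unique-hairpin = Uniqueₚ.++⁺
    (Uniqueₚ.applyUpTo⁺₁ out (suc M) (λ i<j _ → <⇒≢ i<j ∘ +-cancelˡ-≡ 7 _ _ ∘ pt-injectiveˣ))
    (Uniqueₚ.applyDownFrom⁺₁ back (suc M) (λ j<i _ → <⇒≢ j<i ∘ sym ∘ +-cancelˡ-≡ 7 _ _ ∘ pt-injectiveˣ))
    (separated⇒Disjoint {P = λ p → proj₂ p ≡ ℤ.+ 4}
       (All.applyUpTo⁺₂ out (suc M) (λ _ → refl)) (All.applyDownFrom⁺₂ back (suc M) (λ _ ())))

  unique-family : Unique (points family)
  unique-family = subst Unique (sym points-family)
    (Unique-splice (points core₁) unique-core unique-hairpin
       (separated⇒Disjoint {P = λ p → ℤ.+ 7 ℤ.≤ proj₁ p}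
          (All.++⁺ (All.applyUpTo⁺₂ out (suc M) (λ k → ℤ.+≤+ (m≤m+n 7 k)))
                   (All.applyDownFrom⁺₂ back (suc M) (λ k → ℤ.+≤+ (m≤m+n 7 k))))
          (from-yes (All.all? (λ p → ¬? (ℤ.+ 7 ℤ.≤? proj₁ p)) (points core)))))

  linked-family : Linked Adjacent (points family)
  linked-family = subst (Linked Adjacent) (sym (trans points-family (cong (points core₁ ++_) (++-assoc outRow backRow (points core₂)))))
    (Linkedₚ.++⁺ (from-yes (linked? adjacent? (points core₁))) (Connected.just refl)
      (Linkedₚ.++⁺ (Linkedₚ.applyUpTo⁺₂ out (suc M) (λ k → adjacent-east (7 + k) 4))
                   (subst (λ l → Connected Adjacent l (just (back M))) (sym (last-applyUpTo out M))
                          (Connected.just (adjacent-south (7 + M) 3)))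
        (Linkedₚ.++⁺ (Linkedₚ.applyDownFrom⁺₂ back (suc M) (λ k → adjacent-west (7 + k) 3))
                     (subst (λ l → Connected Adjacent l (just (pt 6 3))) (sym (last-applyDownFrom back M)) (Connected.just refl))
                     (from-yes (linked? adjacent? (points core₂))))))

  familyFold : Fold (word family)
  familyFold = chainFold family unique-family linked-family

  Z-family : Z (word family) ≡ 6
  Z-family = cong (3 +_) (Z-polar hairpinPoints core₂)

  M≤length-family : M ≤ length (word family)
  M≤length-family = begin
    M                            ≤⟨ n≤1+n M ⟩
    suc M                        ≡⟨ length-applyUpTo out (suc M) ⟨
    length outRow                ≤⟨ length-++-≤ˡ outRow ⟩
    length hairpinPoints         ≡⟨ length-map polar hairpinPoints ⟨
    length hairpin               ≤⟨ length-++-≤ˡ hairpin ⟩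
    length (hairpin ++ core₂)    ≤⟨ length-++-≤ʳ (hairpin ++ core₂) {core₁} ⟩
    length family                ≡⟨ length-map proj₁ family ⟨
    length (word family)         ∎
    where open ≤-Reasoning

  score-core≤score-family : score (word core) coreFold ≤ score (word family) familyFold
  score-core≤score-family = score-mono coreFold familyFold (embed core₁ hairpin)
    (embed-injective core₁ hairpin) (embed-gap core₁ hairpin 2)
    (embed-lookup core₁ hairpin) (embed-place core₁ hairpin)

theorem2p5 : ∀ (N : ℕ) → Σ Word (λ w → N ≤ length w × JrectIs w (Z w + 1))
theorem2p5 N = word family , M≤length-family , (familyFold , optimal) , score≤Z+1 (word family)
  where
  open Family N
  optimal : score (word family) familyFold ≡ Z (word family) + 1
  optimal = ≤-antisym (score≤Z+1 (word family) familyFold) (begin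
    Z (word family) + 1         ≡⟨ cong (_+ 1) Z-family ⟩
    7                           ≡⟨ score-core ⟨
    score (word core) coreFold  ≤⟨ score-core≤score-family ⟩
    score (word family) familyFold ∎)
    where open ≤-Reasoning
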